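{- Let $\mathcal{H}$ be a connected $r$-uniform hypergraph on $n$ vertices whose longest Berge path has length $r$. If $\mathcal{H}$ contains a Berge cycle of length $r+1$, then $\mathcal{H}$ is the complete $r$-uniform hypergraph on $r+1$ vertices.
   Context: Hypergraphs are simple (no repeated edges). A Berge path of length $k$ is an alternating sequence $v_0e_1v_1\cdots v_{k-1}e_kv_k$ of distinct vertices and distinct edges with $v_{i-1},v_i\in e_i$. A Berge cycle of length $k$ is an alternating sequence $v_0e_1v_1\cdots v_{k-1}e_kv_0$ of distinct vertices and distinct edges with $v_{i-1},v_i\in e_i$ (indices mod $k$). Connected means every two distinct vertices are joined by a Berge path. The complete $r$-uniform hypergraph on a vertex set has all $r$-subsets as edges. -}

module Defs where

open import Data.Nat using (ℕ; zero; suc; _≤_)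
open import Data.Fin using (Fin; toℕ; fromℕ; inject₁)
open import Data.Fin.Subset using (Subset; _∈_; ∣_∣)
open import Data.Bool using (Bool; true)
open import Data.Product using (Σ; ∃; _×_)
open import Data.Sum using (_⊎_)
open import Relation.Binary.PropositionalEquality using (_≡_; _≢_)
open import Function.Definitions using (Injective)
open import Function.Bundles using (_⇔_)

-- A (simple) hypergraph on the vertex set Fin n: its edge set, given as a
-- decidable set of subsets of Fin n (so no edge is repeated).
Hypergraph : ℕ → Set
Hypergraph n = Subset n → Bool

IsEdge : ∀ {n} → Hypergraph n → Subset n → Set
IsEdge H e = H e ≡ true

Uniform : ∀ {n} → ℕ → Hypergraph n → Set
Uniform r H = ∀ e → IsEdge H e → ∣ e ∣ ≡ r

record BergePath {n : ℕ} (H : Hypergraph n) (k : ℕ) : Set where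
  field
    vertex     : Fin (suc k) → Fin n
    edge       : Fin k → Subset n
    vertex-inj : Injective _≡_ _≡_ vertex
    edge-inj   : Injective _≡_ _≡_ edge
    edge-isEdge : ∀ i → IsEdge H (edge i)
    left∈      : ∀ i → vertex (inject₁ i) ∈ edge i
    right∈     : ∀ i → vertex (Fin.suc i) ∈ edge i

CycNext : (k : ℕ) → Fin k → Fin k → Set
CycNext k i j = (suc (toℕ i) ≡ toℕ j) ⊎ (suc (toℕ i) ≡ k × toℕ j ≡ 0)

record BergeCycle {n : ℕ} (H : Hypergraph n) (k : ℕ) : Set where
  field
    vertex     : Fin k → Fin n
    edge       : Fin k → Subset n
    vertex-inj : Injective _≡_ _≡_ vertex
    edge-inj   : Injective _≡_ _≡_ edge
    edge-isEdge : ∀ i → IsEdge H (edge i)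
    here∈      : ∀ i → vertex i ∈ edge i
    next∈      : ∀ i j → CycNext k i j → vertex j ∈ edge i

Connected : ∀ {n} → Hypergraph n → Set
Connected {n} H = ∀ (u w : Fin n) → u ≢ w →
  ∃ λ k → Σ (BergePath H k) λ p →
    BergePath.vertex p Fin.zero ≡ u × BergePath.vertex p (fromℕ k) ≡ w

LongestPathLength : ∀ {n} → Hypergraph n → ℕ → Set
LongestPathLength H r = BergePath H r × (∀ k → BergePath H k → k ≤ r)

IsCompleteOnSucR : ∀ {n} → ℕ → Hypergraph n → Set
IsCompleteOnSucR {n} r H = n ≡ suc r × (∀ e → IsEdge H e ⇔ (∣ e ∣ ≡ r))

{-# OPTIONS --safe #-}
-- Walking once around the (r+1)-cycle C from any of its vertices and dropping the edge
-- just before that vertex gives a path of length r, hence a longest path; so an edge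
-- through its first vertex that is not on the path cannot reach a new vertex. Every edge
-- through a vertex of C is of this kind for a suitable starting point, so the vertex set
-- of C is closed under edges and, H being connected, it is everything: n = r + 1. The
-- r + 1 distinct edges of C are then r + 1 distinct r-subsets of an (r+1)-set, i.e. all.
module Submission where

open import Data.Nat using (ℕ; suc)
open import Defs

open import Data.Bool.Properties using () renaming (_≟_ to _≟ᴮ_)
open import Data.Empty using (⊥-elim)
open import Data.Fin using (Fin; zero; suc; toℕ; fromℕ; fromℕ<; inject₁; punchOut; _≟_)
open import Data.Fin.Induction using (<-weakInduction)
open import Data.Fin.Properties
  using (any?; ¬∀⟶∃¬; toℕ-injective; toℕ-fromℕ; toℕ-fromℕ<; toℕ-inject₁; toℕ<n; fromℕ≢inject₁;
         inject₁-injective; injective⇒≤; punchOut-injective)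
open import Data.Fin.Subset using (Subset; _∈_; _∉_; _⊆_; ∣_∣; ∁; ⁅_⁆; ⊤)
open import Data.Fin.Subset.Properties
  using (_∈?_; ⊆-antisym; p⊆q⇒∣p∣≤∣q∣; p⊂q⇒∣p∣<∣q∣; ∣⊤∣≡n; ∣∁p∣≡n∸∣p∣; ∣⁅x⁆∣≡1;
         x≢y⇒x∉⁅y⁆; x∉p⇒x∈∁p)
open import Data.Nat using (_≤_; _<_; _<?_; _∸_)
open import Data.Nat.Properties using (≤-antisym; <-irrefl; <⇒≱; ≤-refl; 1+n≰n; suc-injective; ≮⇒≥)
open import Data.Product using (Σ; ∃; _,_; proj₁; proj₂)
open import Data.Sum using (inj₁; inj₂)
open import Data.Vec.Properties using (≡-dec)
open import Function.Bundles using (mk⇔)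
open import Function.Definitions using (Injective)
open import Relation.Nullary using (¬_; yes; no)
open import Relation.Nullary.Decidable using (decidable-stable)
open import Relation.Binary.PropositionalEquality

cycSuc : ∀ {r} → Fin (suc r) → Fin (suc r)
cycSuc {r} i with suc (toℕ i) <? suc r
... | yes i+1<1+r = fromℕ< i+1<1+r
... | no _        = zero

CycNext-cycSuc : ∀ {r} (i : Fin (suc r)) → CycNext (suc r) i (cycSuc i)
CycNext-cycSuc {r} i with suc (toℕ i) <? suc r
... | yes i+1<1+r = inj₁ (sym (toℕ-fromℕ< i+1<1+r))
... | no i+1≮1+r  = inj₂ (≤-antisym (toℕ<n i) (≮⇒≥ i+1≮1+r) , refl)

CycNext-inject₁ : ∀ {k} (i : Fin k) → CycNext (suc k) (inject₁ i) (suc i)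
CycNext-inject₁ i = inj₁ (cong suc (toℕ-inject₁ i))

CycNext-fromℕ : ∀ r → CycNext (suc r) (fromℕ r) zero
CycNext-fromℕ r = inj₂ (cong suc (toℕ-fromℕ r) , refl)

CycNext-functional : ∀ {k} {i j j′ : Fin k} → CycNext k i j → CycNext k i j′ → j ≡ j′
CycNext-functional (inj₁ i+1≡j) (inj₁ i+1≡j′) = toℕ-injective (trans (sym i+1≡j) i+1≡j′)
CycNext-functional {j = j} (inj₁ i+1≡j) (inj₂ (i+1≡k , _)) =
  ⊥-elim (<-irrefl (trans (sym i+1≡j) i+1≡k) (toℕ<n j))
CycNext-functional {j′ = j′} (inj₂ (i+1≡k , _)) (inj₁ i+1≡j′) =
  ⊥-elim (<-irrefl (trans (sym i+1≡j′) i+1≡k) (toℕ<n j′))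
CycNext-functional (inj₂ (_ , j≡0)) (inj₂ (_ , j′≡0)) = toℕ-injective (trans j≡0 (sym j′≡0))

CycNext-injective : ∀ {k} {i i′ j : Fin k} → CycNext k i j → CycNext k i′ j → i ≡ i′
CycNext-injective (inj₁ i+1≡j) (inj₁ i′+1≡j) =
  toℕ-injective (suc-injective (trans i+1≡j (sym i′+1≡j)))
CycNext-injective (inj₁ i+1≡j) (inj₂ (_ , j≡0)) with () ← trans i+1≡j j≡0
CycNext-injective (inj₂ (_ , j≡0)) (inj₁ i′+1≡j) with () ← trans i′+1≡j j≡0
CycNext-injective (inj₂ (i+1≡k , _)) (inj₂ (i′+1≡k , _)) =
  toℕ-injective (suc-injective (trans i+1≡k (sym i′+1≡k)))

cycSuc-injective : ∀ {r} → Injective _≡_ _≡_ (cycSuc {r})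
cycSuc-injective {x = i} {j} eq =
  CycNext-injective (CycNext-cycSuc i) (subst (CycNext _ j) (sym eq) (CycNext-cycSuc j))

cycSuc-CycNext : ∀ {r} {i j : Fin (suc r)} →
                 CycNext (suc r) i j → CycNext (suc r) (cycSuc i) (cycSuc j)
cycSuc-CycNext {i = i} i→j =
  subst (λ j → CycNext _ (cycSuc i) (cycSuc j)) (CycNext-functional (CycNext-cycSuc i) i→j)
        (CycNext-cycSuc (cycSuc i))

cycSuc-inject₁ : ∀ {r} (i : Fin r) → cycSuc (inject₁ i) ≡ suc i
cycSuc-inject₁ i = CycNext-functional (CycNext-cycSuc (inject₁ i)) (CycNext-inject₁ i)

record Rotation (k : ℕ) : Set where
  field
    apply     : Fin k → Fin k
    injective : Injective _≡_ _≡_ apply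
    CycNext-preserving : ∀ {i j} → CycNext k i j → CycNext k (apply i) (apply j)

open Rotation

rotationFrom : ∀ {r} (i : Fin (suc r)) → Σ (Rotation (suc r)) λ ρ → apply ρ zero ≡ i
rotationFrom = <-weakInduction _ identity step
  where
  identity : Σ (Rotation _) λ ρ → apply ρ zero ≡ zero
  identity =
    record { apply = λ i → i ; injective = λ eq → eq ; CycNext-preserving = λ i→j → i→j } , refl

  step : ∀ {r} (i : Fin r) → Σ (Rotation (suc r)) (λ ρ → apply ρ zero ≡ inject₁ i) →
         Σ (Rotation (suc r)) (λ ρ → apply ρ zero ≡ suc i)
  step i (ρ , ρ0≡i) =
    record { apply = λ j → cycSuc (apply ρ j)
           ; injective = λ eq → injective ρ (cycSuc-injective eq)
           ; CycNext-preserving = λ i→j → cycSuc-CycNext (CycNext-preserving ρ i→j) } ,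
    trans (cong cycSuc ρ0≡i) (cycSuc-inject₁ i)

apply-fromℕ : ∀ {r} {p : Fin (suc r)} (ρ : Rotation (suc r)) →
              apply ρ zero ≡ cycSuc p → apply ρ (fromℕ r) ≡ p
apply-fromℕ {r} {p} ρ ρ0≡p+1 =
  CycNext-injective (subst (CycNext _ _) ρ0≡p+1 (CycNext-preserving ρ (CycNext-fromℕ r)))
                    (CycNext-cycSuc p)

module _ {n} {H : Hypergraph n} where

  rotate : ∀ {k} → Rotation k → BergeCycle H k → BergeCycle H k
  rotate ρ C = record
    { vertex = λ i → vertex (apply ρ i)
    ; edge = λ i → edge (apply ρ i)
    ; vertex-inj = λ eq → injective ρ (vertex-inj eq)
    ; edge-inj = λ eq → injective ρ (edge-inj eq)
    ; edge-isEdge = λ i → edge-isEdge (apply ρ i)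
    ; here∈ = λ i → here∈ (apply ρ i)
    ; next∈ = λ i j i→j → next∈ (apply ρ i) (apply ρ j) (CycNext-preserving ρ i→j)
    }
    where open BergeCycle C

  dropLastEdge : ∀ {r} → BergeCycle H (suc r) → BergePath H r
  dropLastEdge C = record
    { vertex = vertex
    ; edge = λ i → edge (inject₁ i)
    ; vertex-inj = vertex-inj
    ; edge-inj = λ eq → inject₁-injective (edge-inj eq)
    ; edge-isEdge = λ i → edge-isEdge (inject₁ i)
    ; left∈ = λ i → here∈ (inject₁ i)
    ; right∈ = λ i → next∈ (inject₁ i) (suc i) (CycNext-inject₁ i)
    }
    where open BergeCycle C

  prepend : ∀ {k f u} (P : BergePath H k) → IsEdge H f → u ∈ f → BergePath.vertex P zero ∈ f →
            (∀ i → BergePath.vertex P i ≢ u) → (∀ i → BergePath.edge P i ≢ f) → BergePath H (suc k)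
  prepend {k} {f} {u} P f∈H u∈f start∈f u∉P f∉P = record
    { vertex = vertex′ ; edge = edge′ ; vertex-inj = vertex′-inj ; edge-inj = edge′-inj
    ; edge-isEdge = edge′-isEdge ; left∈ = left∈′ ; right∈ = right∈′ }
    where
    open BergePath P
    vertex′ : Fin (suc (suc k)) → Fin n
    vertex′ zero    = u
    vertex′ (suc i) = vertex i
    edge′ : Fin (suc k) → Subset n
    edge′ zero    = f
    edge′ (suc i) = edge i
    vertex′-inj : Injective _≡_ _≡_ vertex′
    vertex′-inj {zero}  {zero}  _  = refl
    vertex′-inj {zero}  {suc j} eq = ⊥-elim (u∉P j (sym eq))
    vertex′-inj {suc i} {zero}  eq = ⊥-elim (u∉P i eq)
    vertex′-inj {suc i} {suc j} eq = cong suc (vertex-inj eq)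
    edge′-inj : Injective _≡_ _≡_ edge′
    edge′-inj {zero}  {zero}  _  = refl
    edge′-inj {zero}  {suc j} eq = ⊥-elim (f∉P j (sym eq))
    edge′-inj {suc i} {zero}  eq = ⊥-elim (f∉P i eq)
    edge′-inj {suc i} {suc j} eq = cong suc (edge-inj eq)
    edge′-isEdge : ∀ i → IsEdge H (edge′ i)
    edge′-isEdge zero    = f∈H
    edge′-isEdge (suc i) = edge-isEdge i
    left∈′ : ∀ i → vertex′ (inject₁ i) ∈ edge′ i
    left∈′ zero    = u∈f
    left∈′ (suc i) = left∈ i
    right∈′ : ∀ i → vertex′ (suc i) ∈ edge′ i
    right∈′ zero    = start∈f
    right∈′ (suc i) = right∈ i

  maximalPath-startEdge⊆path : ∀ {k f u} → ¬ BergePath H (suc k) → (P : BergePath H k) →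
    IsEdge H f → BergePath.vertex P zero ∈ f → (∀ i → BergePath.edge P i ≢ f) →
    u ∈ f → ∃ λ i → BergePath.vertex P i ≡ u
  maximalPath-startEdge⊆path {u = u} maximal P f∈H start∈f f∉P u∈f =
    decidable-stable (any? λ i → BergePath.vertex P i ≟ u)
      λ u∉P → maximal (prepend P f∈H u∈f start∈f (λ i eq → u∉P (i , eq)) f∉P)

  connected-closed⇒universal : Connected H → (S : Fin n → Set) →
    (∀ {f w u} → IsEdge H f → S w → w ∈ f → u ∈ f → S u) → ∀ {v} → S v → ∀ u → S u
  connected-closed⇒universal conn S closed {v} Sv u with v ≟ u
  ... | yes refl = Sv
  ... | no v≢u with conn v u v≢u
  ... | k , P , start≡v , end≡u =
    subst S end≡u (<-weakInduction (λ i → S (vertex i)) (subst S (sym start≡v) Sv)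
      (λ i S-i → closed (edge-isEdge i) S-i (left∈ i) (right∈ i)) (fromℕ k))
    where open BergePath P

  OnCycle : ∀ {k} → BergeCycle H k → Fin n → Set
  OnCycle C u = ∃ λ i → BergeCycle.vertex C i ≡ u

  rotatedPath-edge⊆cycle : ∀ {r} → ¬ BergePath H (suc r) →
    (C : BergeCycle H (suc r)) (ρ : Rotation (suc r)) →
    ∀ {f u} → IsEdge H f → BergeCycle.vertex C (apply ρ zero) ∈ f →
    (∀ i → BergeCycle.edge C (apply ρ (inject₁ i)) ≢ f) → u ∈ f → OnCycle C u
  rotatedPath-edge⊆cycle maximal C ρ f∈H start∈f f∉P u∈f
    with i , v-i≡u ← maximalPath-startEdge⊆path maximal (dropLastEdge (rotate ρ C))
                                                   f∈H start∈f f∉P u∈f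
    = apply ρ i , v-i≡u

  -- Walk around C from a vertex of f, dropping the edge just before it; when f is the
  -- cycle edge e_p, start at v_{p+1} ∈ e_p, so that the dropped edge is f itself.
  maximalCycle-edge-closed : ∀ {r} → ¬ BergePath H (suc r) → (C : BergeCycle H (suc r)) →
    ∀ {f w u} → IsEdge H f → OnCycle C w → w ∈ f → u ∈ f → OnCycle C u
  maximalCycle-edge-closed {r} maximal C {f} f∈H (i , refl) v-i∈f u∈f
    with any? (λ p → ≡-dec _≟ᴮ_ (BergeCycle.edge C p) f)
  ... | yes (p , refl)
    with ρ , ρ0≡p+1 ← rotationFrom (cycSuc p)
    = rotatedPath-edge⊆cycle maximal C ρ f∈H
        (next∈ p (apply ρ zero) (subst (CycNext _ p) (sym ρ0≡p+1) (CycNext-cycSuc p)))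
        (λ j eq → fromℕ≢inject₁ (injective ρ (trans (apply-fromℕ ρ ρ0≡p+1) (sym (edge-inj eq)))))
        u∈f
    where open BergeCycle C
  ... | no f∉C
    with ρ , ρ0≡i ← rotationFrom i
    = rotatedPath-edge⊆cycle maximal C ρ f∈H
        (subst (λ j → BergeCycle.vertex C j ∈ f) (sym ρ0≡i) v-i∈f)
        (λ j eq → f∉C (apply ρ (inject₁ j) , eq))
        u∈f

injective⇒surjective : ∀ {n} {f : Fin n → Fin n} → Injective _≡_ _≡_ f → ∀ y → ∃ λ x → f x ≡ y
injective⇒surjective {suc n} {f} f-inj y =
  decidable-stable (any? λ x → f x ≟ y) λ y∉im → 1+n≰n (injective⇒≤ (g-inj y∉im))
  where
  g-inj : (y∉im : ¬ ∃ λ x → f x ≡ y) →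
          Injective _≡_ _≡_ (λ x → punchOut {i = y} {j = f x} λ y≡fx → y∉im (x , sym y≡fx))
  g-inj y∉im {x} {x′} eq =
    f-inj (punchOut-injective (λ y≡fx → y∉im (x , sym y≡fx)) (λ y≡fx′ → y∉im (x′ , sym y≡fx′)) eq)

injective∧surjective⇒≡ : ∀ {m n} {f : Fin m → Fin n} →
  Injective _≡_ _≡_ f → (∀ y → ∃ λ x → f x ≡ y) → m ≡ n
injective∧surjective⇒≡ {f = f} f-inj f-surj =
  ≤-antisym (injective⇒≤ f-inj) (injective⇒≤ section-inj)
  where
  section-inj : Injective _≡_ _≡_ (λ y → proj₁ (f-surj y))
  section-inj {y} {y′} eq = trans (sym (proj₂ (f-surj y))) (trans (cong f eq) (proj₂ (f-surj y′)))

∣p∣<n⇒∃∉ : ∀ {n} (p : Subset n) → ∣ p ∣ < n → ∃ λ x → x ∉ p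
∣p∣<n⇒∃∉ {n} p ∣p∣<n = ¬∀⟶∃¬ n (_∈ p) (_∈? p) λ ⊤⊆p →
  <⇒≱ ∣p∣<n (subst (_≤ ∣ p ∣) (∣⊤∣≡n n) (p⊆q⇒∣p∣≤∣q∣ {p = ⊤} (λ {x} _ → ⊤⊆p x)))

p⊆q∧∣p∣≡∣q∣⇒p≡q : ∀ {n} {p q : Subset n} → p ⊆ q → ∣ p ∣ ≡ ∣ q ∣ → p ≡ q
p⊆q∧∣p∣≡∣q∣⇒p≡q {p = p} p⊆q ∣p∣≡∣q∣ = ⊆-antisym p⊆q λ {x} x∈q →
  decidable-stable (x ∈? p) λ x∉p → <-irrefl ∣p∣≡∣q∣ (p⊂q⇒∣p∣<∣q∣ (p⊆q , x , x∈q , x∉p))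

∣p∣≡n⇒p≡∁⁅x⁆ : ∀ {n} (p : Subset (suc n)) → ∣ p ∣ ≡ n → ∃ λ x → p ≡ ∁ ⁅ x ⁆
∣p∣≡n⇒p≡∁⁅x⁆ {n} p ∣p∣≡n with x , x∉p ← ∣p∣<n⇒∃∉ p (subst (_< suc n) (sym ∣p∣≡n) ≤-refl) =
  x , p⊆q∧∣p∣≡∣q∣⇒p≡q p⊆∁⁅x⁆ (trans ∣p∣≡n (sym ∣∁⁅x⁆∣≡n))
  where
  p⊆∁⁅x⁆ : p ⊆ ∁ ⁅ x ⁆
  p⊆∁⁅x⁆ y∈p = x∉p⇒x∈∁p (x≢y⇒x∉⁅y⁆ λ { refl → x∉p y∈p })
  ∣∁⁅x⁆∣≡n : ∣ ∁ ⁅ x ⁆ ∣ ≡ n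
  ∣∁⁅x⁆∣≡n = trans (∣∁p∣≡n∸∣p∣ ⁅ x ⁆) (cong (suc n ∸_) (∣⁅x⁆∣≡1 x))

-- An n-subset of Fin (suc n) is the complement of its missing point, and the missing
-- points of the E i are pairwise distinct, hence exhaust Fin (suc n).
injective-family-of-n-subsets-surjective : ∀ {n} (E : Fin (suc n) → Subset (suc n)) →
  Injective _≡_ _≡_ E → (∀ i → ∣ E i ∣ ≡ n) → ∀ e → ∣ e ∣ ≡ n → ∃ λ i → E i ≡ e
injective-family-of-n-subsets-surjective {n} E E-inj ∣E∣≡n e ∣e∣≡n =
  i , trans (E≡∁⁅missing⁆ i) (trans (cong (λ y → ∁ ⁅ y ⁆) missing-i≡x) (sym e≡∁⁅x⁆))
  where
  missing : Fin (suc n) → Fin (suc n)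
  missing i = proj₁ (∣p∣≡n⇒p≡∁⁅x⁆ (E i) (∣E∣≡n i))
  E≡∁⁅missing⁆ : ∀ i → E i ≡ ∁ ⁅ missing i ⁆
  E≡∁⁅missing⁆ i = proj₂ (∣p∣≡n⇒p≡∁⁅x⁆ (E i) (∣E∣≡n i))
  missing-inj : Injective _≡_ _≡_ missing
  missing-inj {i} {j} eq =
    E-inj (trans (E≡∁⁅missing⁆ i) (trans (cong (λ y → ∁ ⁅ y ⁆) eq) (sym (E≡∁⁅missing⁆ j))))
  x : Fin (suc n)
  x = proj₁ (∣p∣≡n⇒p≡∁⁅x⁆ e ∣e∣≡n)
  e≡∁⁅x⁆ : e ≡ ∁ ⁅ x ⁆
  e≡∁⁅x⁆ = proj₂ (∣p∣≡n⇒p≡∁⁅x⁆ e ∣e∣≡n)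
  i : Fin (suc n)
  i = proj₁ (injective⇒surjective missing-inj x)
  missing-i≡x : missing i ≡ x
  missing-i≡x = proj₂ (injective⇒surjective missing-inj x)

spanning-cycle-edges-complete : ∀ {n r} {H : Hypergraph n} → n ≡ suc r → Uniform r H →
  BergeCycle H (suc r) → ∀ e → ∣ e ∣ ≡ r → IsEdge H e
spanning-cycle-edges-complete refl U C e ∣e∣≡r
  with i , refl ← injective-family-of-n-subsets-surjective
                    (BergeCycle.edge C) (BergeCycle.edge-inj C)
                    (λ i → U _ (BergeCycle.edge-isEdge C i)) e ∣e∣≡r
  = BergeCycle.edge-isEdge C i

corollary3p3 : (n r : ℕ) (H : Hypergraph n) →
    Uniform r H → Connected H → LongestPathLength H r →
    BergeCycle H (suc r) → IsCompleteOnSucR r H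
corollary3p3 n r H U conn (_ , longest) C =
  n≡1+r , λ e → mk⇔ (U e) (spanning-cycle-edges-complete n≡1+r U C e)
  where
  maximal : ¬ BergePath H (suc r)
  maximal P = 1+n≰n (longest (suc r) P)

  C-spanning : ∀ u → OnCycle C u
  C-spanning =
    connected-closed⇒universal conn (OnCycle C) (maximalCycle-edge-closed maximal C) (zero , refl)

  n≡1+r : n ≡ suc r
  n≡1+r = sym (injective∧surjective⇒≡ (BergeCycle.vertex-inj C) C-spanning)
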